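{- Let $\mathcal{S}\subseteq 2^{[n]}$ and let $M\in\{0,1\}^{|\mathcal{S}|\times n}$ be its incidence matrix (rows indexed by sets, columns by coordinates, $M_{S,i}=1$ iff $i\in S$). Then $\mathrm{HHdim}(\mathcal{S})$ equals the maximum size (number of rows/columns) of a square submatrix of $M$ that is a permutation matrix.
   Context: Subsets are identified with $0/1$ vectors; $u\circ v$ is the coordinatewise product and $\operatorname{supp}(v)=\{i:v_i\ne0\}$. $H(\mathcal{S},v)=\{i\in[n]:\exists s\in\mathcal{S}\text{ with }\operatorname{supp}(s\circ v)=\{i\}\}$ and $\mathrm{HHdim}(\mathcal{S})=\sup_{v\in\mathbb{R}^n}|H(\mathcal{S},v)|$. A permutation matrix is a square $0/1$ matrix with exactly one $1$ in every row and every column; a submatrix is obtained by selecting some rows and some columns.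
   Formalization: The vectors $v$ in the supremum defining $\mathrm{HHdim}(\mathcal{S})$ range over ℚ^n rather than $\mathbb{R}^n$. -}

module Defs where

open import Data.Nat using (ℕ; _≤_)
open import Data.Fin using (Fin)
open import Data.Bool using (Bool; true; false)
open import Data.Rational using (ℚ; 0ℚ; 1ℚ; _*_)
open import Data.Product using (Σ; _×_)
open import Relation.Binary.PropositionalEquality using (_≡_; _≢_)
open import Function.Definitions using (Injective)

Subset : ℕ → Set
Subset n = Fin n → Bool

-- A finite family 𝒮 ⊆ 2^[n] is given as an injective enumeration
-- S : Fin m → Subset n (so m = |𝒮|).  Its incidence matrix is
-- M S j i = S j i  (rows = sets, columns = coordinates).
Family : ℕ → ℕ → Set
Family m n = Fin m → Subset n

IsSetFamily : ∀ {m n} → Family m n → Set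
IsSetFamily S = Injective _≡_ _≡_ S

𝟙 : Bool → ℚ
𝟙 true  = 1ℚ
𝟙 false = 0ℚ

_∘v_ : ∀ {n} → Subset n → (Fin n → ℚ) → (Fin n → ℚ)
(s ∘v v) l = 𝟙 (s l) * v l

SuppIsSingleton : ∀ {n} → (Fin n → ℚ) → Fin n → Set
SuppIsSingleton w i = ∀ l → (w l ≢ 0ℚ → l ≡ i) × (l ≡ i → w l ≢ 0ℚ)

InH : ∀ {m n} → Family m n → (Fin n → ℚ) → Fin n → Set
InH S v i = Σ _ λ j → SuppIsSingleton (S j ∘v v) i

HSizeAtLeast : ∀ {m n} → Family m n → (Fin n → ℚ) → ℕ → Set
HSizeAtLeast {n = n} S v k =
  Σ (Fin k → Fin n) λ f → Injective _≡_ _≡_ f × (∀ t → InH S v (f t))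

-- HHdim(𝒮) = k  (the supremum is a maximum since |H| ≤ n)
IsHHdim : ∀ {m n} → Family m n → ℕ → Set
IsHHdim {n = n} S k =
  Σ (Fin n → ℚ) (λ v → HSizeAtLeast S v k)
  × (∀ (v : Fin n → ℚ) k' → HSizeAtLeast S v k' → k' ≤ k)

IsPermutationMatrix : ∀ {k} → (Fin k → Fin k → Bool) → Set
IsPermutationMatrix {k} P =
  (∀ a → Σ (Fin k) λ b → P a b ≡ true × (∀ b' → P a b' ≡ true → b' ≡ b))
  × (∀ b → Σ (Fin k) λ a → P a b ≡ true × (∀ a' → P a' b ≡ true → a' ≡ a))

HasPermSubmatrix : ∀ {m n} → (Fin m → Fin n → Bool) → ℕ → Set
HasPermSubmatrix {m} {n} M k =
  Σ (Fin k → Fin m) λ r → Σ (Fin k → Fin n) λ c →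
    Injective _≡_ _≡_ r × Injective _≡_ _≡_ c
    × IsPermutationMatrix (λ a b → M (r a) (c b))

IsMaxPermSubmatrixSize : ∀ {m n} → (Fin m → Fin n → Bool) → ℕ → Set
IsMaxPermSubmatrixSize M k =
  HasPermSubmatrix M k × (∀ k' → HasPermSubmatrix M k' → k' ≤ k)

-- A family of k distinct columns in which every chosen column is "isolated" (some set of 𝒮
-- meets the chosen columns in that column alone) is the same thing as a k × k permutation
-- submatrix: the isolating rows are automatically distinct.  It also gives k elements of
-- H(𝒮, v) for v the indicator vector of the chosen columns; conversely, every i ∈ H(𝒮, v)
-- satisfies v i ≠ 0, so H(𝒮, v) itself is a family of isolated columns.  Both quantities are
-- therefore the largest size of an isolated column family, which exists because such
-- families are decidable and have size at most n.
module Submission where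

open import Defs
open import Data.Nat using (ℕ; zero; suc; _≤_; s≤s⁻¹)
open import Data.Nat.Properties using (≤∧≢⇒<)
open import Data.Product using (Σ; ∃; _×_; _,_; proj₁; proj₂)
open import Data.Fin using (Fin; _≟_)
open import Data.Fin.Properties using (any?; all?; injective⇒≤)
open import Data.Vec using (Vec; []; _∷_; lookup; tabulate)
open import Data.Vec.Properties using (lookup∘tabulate)
open import Data.Bool using (Bool; true; false)
import Data.Bool as Bool
open import Data.Rational using (ℚ; 0ℚ; _*_)
open import Data.Rational.Properties using (*-identityˡ; *-zeroʳ; *-zeroˡ)
open import Relation.Nullary using (Dec; yes; no; does; contradiction)
open import Relation.Nullary.Decidable using (_×-dec_; _→-dec_; map′)
open import Relation.Unary using (Pred; Decidable)
open import Relation.Binary.PropositionalEquality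
  using (_≡_; _≢_; _≗_; refl; sym; trans; cong; subst)
open import Function.Definitions using (Injective)

bounded-maximum : ∀ {p} {P : Pred ℕ p} → Decidable P → P 0 →
  ∀ n → (∀ k → P k → k ≤ n) → ∃ λ k → P k × (∀ k′ → P k′ → k′ ≤ k)
bounded-maximum P? p₀ n bound with P? n
... | yes pₙ = n , pₙ , bound
bounded-maximum P? p₀ zero    bound | no ¬pₙ = contradiction p₀ ¬pₙ
bounded-maximum P? p₀ (suc n) bound | no ¬pₙ =
  bounded-maximum P? p₀ n λ k pₖ → s≤s⁻¹ (≤∧≢⇒< (bound k pₖ) λ { refl → ¬pₙ pₖ })

anyVec? : ∀ {n p} k {P : Pred (Vec (Fin n) k) p} → Decidable P → Dec (∃ P)
anyVec? zero    P? = map′ ([] ,_) (λ { ([] , p) → p }) (P? [])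
anyVec? (suc k) P? =
  map′ (λ (x , xs , p) → x ∷ xs , p) (λ { (x ∷ xs , p) → x , xs , p })
       (any? λ x → anyVec? k (λ xs → P? (x ∷ xs)))

anyFunction? : ∀ {k n p} {P : Pred (Fin k → Fin n) p} →
  (∀ {f g} → f ≗ g → P f → P g) → Decidable P → Dec (∃ P)
anyFunction? {k} resp P? =
  map′ (λ (xs , p) → lookup xs , p)
       (λ (f , p) → tabulate f , resp (λ a → sym (lookup∘tabulate f a)) p)
       (anyVec? k (λ xs → P? (lookup xs)))

𝟙*-≢0⇒ : ∀ x q → 𝟙 x * q ≢ 0ℚ → x ≡ true × q ≢ 0ℚ
𝟙*-≢0⇒ true  q ne = refl , λ q≡0 → ne (trans (*-identityˡ q) q≡0)
𝟙*-≢0⇒ false q ne = contradiction (*-zeroˡ q) ne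

⇒𝟙*-≢0 : ∀ {x q} → x ≡ true → q ≢ 0ℚ → 𝟙 x * q ≢ 0ℚ
⇒𝟙*-≢0 {q = q} refl q≢0 eq = q≢0 (trans (sym (*-identityˡ q)) eq)

𝟙-does-≢0⇒ : ∀ {p} {P : Set p} (P? : Dec P) → 𝟙 (does P?) ≢ 0ℚ → P
𝟙-does-≢0⇒ (yes p) _  = p
𝟙-does-≢0⇒ (no _)  ne = contradiction refl ne

⇒𝟙-does-≢0 : ∀ {p} {P : Set p} (P? : Dec P) → P → 𝟙 (does P?) ≢ 0ℚ
⇒𝟙-does-≢0 (yes _) _ ()
⇒𝟙-does-≢0 (no ¬p) p = contradiction p ¬p

inH⇒≢0 : ∀ {m n} {S : Family m n} {v i} → InH S v i → v i ≢ 0ℚ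
inH⇒≢0 {S = S} {v} {i} (j , supp) = proj₂ (𝟙*-≢0⇒ (S j i) (v i) (proj₂ (supp i) refl))

module _ {m n : ℕ} (S : Family m n) where

  InImage : ∀ {k} → (Fin k → Fin n) → Fin n → Set
  InImage c l = ∃ λ a → c a ≡ l

  inImage? : ∀ {k} (c : Fin k → Fin n) l → Dec (InImage c l)
  inImage? c l = any? λ a → c a ≟ l

  Isolates : ∀ {k} → Fin m → (Fin k → Fin n) → Fin k → Set
  Isolates j c b = ∀ l → (S j l ≡ true × InImage c l → l ≡ c b)
                       × (l ≡ c b → S j l ≡ true × InImage c l)

  IsolatedColumns : ∀ {k} → (Fin k → Fin n) → Set
  IsolatedColumns c = Injective _≡_ _≡_ c × (∀ b → ∃ λ j → Isolates j c b)

  HasIsolatedColumns : ℕ → Set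
  HasIsolatedColumns k = ∃ λ (c : Fin k → Fin n) → IsolatedColumns c

  isolatedColumns? : ∀ {k} (c : Fin k → Fin n) → Dec (IsolatedColumns c)
  isolatedColumns? c = injective? ×-dec all? λ b → any? λ j → all? λ l →
      ((S j l Bool.≟ true ×-dec inImage? c l) →-dec (l ≟ c b))
      ×-dec ((l ≟ c b) →-dec (S j l Bool.≟ true ×-dec inImage? c l))
    where
    injective? : Dec (Injective _≡_ _≡_ c)
    injective? = map′ (λ inj {a} {b} → inj a b) (λ inj a b → inj {a} {b})
                      (all? λ a → all? λ b → (c a ≟ c b) →-dec (a ≟ b))

  isolatedColumns-resp-≗ : ∀ {k} {c c′ : Fin k → Fin n} →
    c ≗ c′ → IsolatedColumns c → IsolatedColumns c′
  isolatedColumns-resp-≗ {c = c} {c′} c≗c′ (inj , isolated) =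
    (λ {a} {b} e → inj (trans (c≗c′ a) (trans e (sym (c≗c′ b))))) ,
    λ b → let (j , iso) = isolated b in j , λ l →
      (λ (s , a , c′a≡l) → trans (proj₁ (iso l) (s , a , trans (c≗c′ a) c′a≡l)) (c≗c′ b)) ,
      (λ l≡c′b → let (s , a , ca≡l) = proj₂ (iso l) (trans l≡c′b (sym (c≗c′ b)))
                 in s , a , trans (sym (c≗c′ a)) ca≡l)

  hasIsolatedColumns? : ∀ k → Dec (HasIsolatedColumns k)
  hasIsolatedColumns? k = anyFunction? isolatedColumns-resp-≗ isolatedColumns?

  hasIsolatedColumns-0 : HasIsolatedColumns 0
  hasIsolatedColumns-0 = (λ ()) , (λ { {()} }) , (λ ())

  hasIsolatedColumns⇒≤ : ∀ k → HasIsolatedColumns k → k ≤ n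
  hasIsolatedColumns⇒≤ k (c , inj , _) = injective⇒≤ inj

  isolatedColumns⇒permSubmatrix : ∀ {k} {c : Fin k → Fin n} →
    IsolatedColumns c → HasPermSubmatrix S k
  isolatedColumns⇒permSubmatrix {k} {c} (inj , isolated) =
    r , c , r-injective , inj , (λ a → a , diagonal a , offDiagonal a) ,
    (λ b → b , diagonal b , λ a e → sym (offDiagonal a b e))
    where
    r : Fin k → Fin m
    r b = proj₁ (isolated b)

    offDiagonal : ∀ a b → S (r a) (c b) ≡ true → b ≡ a
    offDiagonal a b e = inj (proj₁ (proj₂ (isolated a) (c b)) (e , b , refl))

    diagonal : ∀ a → S (r a) (c a) ≡ true
    diagonal a = proj₁ (proj₂ (proj₂ (isolated a) (c a)) refl)

    r-injective : Injective _≡_ _≡_ r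
    r-injective {a} {b} e = offDiagonal b a (subst (λ j → S j (c a) ≡ true) e (diagonal a))

  permSubmatrix⇒hasIsolatedColumns : ∀ {k} → HasPermSubmatrix S k → HasIsolatedColumns k
  permSubmatrix⇒hasIsolatedColumns (r , c , _ , inj , rows , cols) =
    c , inj , λ b → let (a , Sab , _) = cols b in r a , λ l →
      (λ { (Sal , b′ , refl) → let (_ , _ , unique) = rows a in
                               cong c (trans (unique b′ Sal) (sym (unique b Sab))) }) ,
      (λ { refl → Sab , b , refl })

  hSizeAtLeast⇒hasIsolatedColumns : ∀ {v k} → HSizeAtLeast S v k → HasIsolatedColumns k
  hSizeAtLeast⇒hasIsolatedColumns {v} (f , inj , inH) =
    f , inj , λ b → let (j , supp) = inH b in j , λ l →
      (λ { (Sjl , a , refl) → proj₁ (supp (f a)) (⇒𝟙*-≢0 Sjl (inH⇒≢0 {S = S} {v} (inH a))) }) ,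
      (λ { refl → proj₁ (𝟙*-≢0⇒ (S j (f b)) (v (f b)) (proj₂ (supp (f b)) refl)) , b , refl })

  indicator : ∀ {k} → (Fin k → Fin n) → Fin n → ℚ
  indicator c l = 𝟙 (does (inImage? c l))

  isolatedColumns⇒hSizeAtLeast : ∀ {k} {c : Fin k → Fin n} →
    IsolatedColumns c → HSizeAtLeast S (indicator c) k
  isolatedColumns⇒hSizeAtLeast {c = c} (inj , isolated) =
    c , inj , λ b → let (j , iso) = isolated b in j , λ l →
      (λ ne → let (Sjl , ind≢0) = 𝟙*-≢0⇒ (S j l) (indicator c l) ne
              in proj₁ (iso l) (Sjl , 𝟙-does-≢0⇒ (inImage? c l) ind≢0)) ,
      (λ l≡cb → let (Sjl , im) = proj₂ (iso l) l≡cb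
                in ⇒𝟙*-≢0 Sjl (⇒𝟙-does-≢0 (inImage? c l) im))

mainTheorem9 : (m n : ℕ) (S : Family m n) → IsSetFamily S →
    Σ ℕ λ k → IsHHdim S k × IsMaxPermSubmatrixSize S k
mainTheorem9 m n S _ =
  let (k , (c , isolated) , maximal) =
        bounded-maximum (hasIsolatedColumns? S) (hasIsolatedColumns-0 S) n
                        (hasIsolatedColumns⇒≤ S)
  in k ,
     ((indicator S c , isolatedColumns⇒hSizeAtLeast S isolated) ,
      λ _ k′ h → maximal k′ (hSizeAtLeast⇒hasIsolatedColumns S h)) ,
     (isolatedColumns⇒permSubmatrix S isolated ,
      λ k′ p → maximal k′ (permSubmatrix⇒hasIsolatedColumns S p))
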